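{- If $G$ is a connected cubic graph, then (a) $\gamma_c(G) \ge \mu(G) - 1$, and (b) $\gamma_c(G) \ge \alpha(G) - 1$.
   Context: All graphs are finite, simple and undirected; a cubic graph is a $3$-regular graph. $\gamma_c(G)$ is the minimum cardinality of a connected dominating set of $G$ (a set $S$ such that every vertex outside $S$ has a neighbor in $S$ and $G[S]$ is connected). $\mu(G)$ is the maximum cardinality of a matching of $G$, and $\alpha(G)$ is the independence number of $G$. -}

module Defs where

open import Data.Nat using (ℕ)
open import Data.Fin using (Fin)
open import Data.Fin.Subset using (Subset; _∈_; _∉_; ∣_∣)
open import Data.List using (List; []; _∷_; length; concatMap)
open import Data.List.Relation.Unary.All using (All)
open import Data.List.Relation.Unary.Unique.Propositional using (Unique)
import Data.List.Membership.Propositional as LM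
open import Data.Unit using (⊤)
open import Data.Product using (Σ; ∃; _×_; _,_)
open import Relation.Nullary using (¬_)
open import Relation.Binary.PropositionalEquality using (_≡_)
open import Function.Bundles using (_⇔_)

record Graph (n : ℕ) : Set₁ where
  field
    Adj     : Fin n → Fin n → Set
    sym     : ∀ {u v} → Adj u v → Adj v u
    irrefl  : ∀ {u} → ¬ Adj u u
open Graph public

data WalkIn {n : ℕ} (G : Graph n) (S : Fin n → Set) : Fin n → Fin n → Set where
  here  : ∀ {u} → S u → WalkIn G S u u
  step  : ∀ {u w v} → S u → Adj G u w → WalkIn G S w v → WalkIn G S u v

Connected : ∀ {n} → Graph n → Set
Connected G = ∀ u v → WalkIn G (λ _ → ⊤) u v

Cubic : ∀ {n} → Graph n → Set
Cubic {n} G = ∀ v → Σ (List (Fin n)) λ N →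
  length N ≡ 3 × Unique N × (∀ w → (Adj G v w ⇔ w LM.∈ N))

IsConnectedDominating : ∀ {n} → Graph n → Subset n → Set
IsConnectedDominating {n} G S =
  (∀ v → v ∉ S → ∃ λ u → u ∈ S × Adj G v u) ×
  (∀ u v → u ∈ S → v ∈ S → WalkIn G (λ x → x ∈ S) u v)

endpoints : ∀ {n} → List (Fin n × Fin n) → List (Fin n)
endpoints = concatMap (λ { (u , v) → u ∷ v ∷ [] })

IsMatching : ∀ {n} → Graph n → List (Fin n × Fin n) → Set
IsMatching G M = All (λ { (u , v) → Adj G u v }) M × Unique (endpoints M)

IsIndependent : ∀ {n} → Graph n → Subset n → Set
IsIndependent G I = ∀ u v → u ∈ I → v ∈ I → ¬ Adj G u v

-- Explore a connected dominating set S from one of its vertices, each step adding a vertex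
-- s ∈ S adjacent to the explored part T. In a graph of degree d + 1 the closed neighbourhood
-- of T grows by at most d per step, since the neighbour of s in T is already covered; as S
-- dominates, n ≤ d ∣S∣ + 2, i.e. n ≤ 2 γ_c + 2 for cubic graphs. A matching has 2 μ distinct
-- endpoints, and double counting the edges leaving an independent set I of a regular graph
-- gives ∣I∣ ≤ n − ∣I∣. Hence 2 μ ≤ n and 2 α ≤ n, and both bounds follow after halving.
module Submission where

open import Defs
open import Data.Nat using (ℕ; zero; suc; _+_; _*_; _∸_; _≤_; _<_; z≤n; s≤s)
open import Data.Nat.Properties
open import Data.Fin using (Fin; zero; suc)
open import Data.Fin.Properties using (any?)
open import Data.Fin.Subset
  using (Subset; ∣_∣; _∈_; _∉_; _⊆_; _⊂_; _⊃_; _∪_; _∩_; ⁅_⁆; ⋃; ⊤; ∁; Nonempty; inside; outside)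
open import Data.Fin.Subset.Properties
open import Data.Fin.Subset.Induction using (⊃-wellFounded)
open import Data.List using (List; []; _∷_; length; map)
import Data.List.Membership.Propositional as List
open import Data.List.Relation.Unary.Any using (here; there)
open import Data.List.Relation.Unary.AllPairs using (_∷_)
open import Data.List.Relation.Unary.All.Properties using (All¬⇒¬Any)
open import Data.List.Relation.Unary.Unique.Propositional using (Unique)
open import Data.Vec using ([]; _∷_)
open import Data.Product using (Σ; ∃₂; _×_; _,_; proj₁; proj₂)
open import Data.Sum using (_⊎_; inj₁; inj₂; [_,_])
open import Data.Bool using (if_then_else_)
open import Function using (_∘_)
open import Function.Bundles using (_⇔_; Equivalence; mk⇔)
open import Induction.WellFounded using (Acc; acc)
open import Relation.Nullary using (¬_; does; yes; no; contradiction)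
open import Relation.Nullary.Decidable using (_×-dec_; ¬?; decidable-stable)
open import Relation.Unary using (Decidable)
open import Relation.Binary.PropositionalEquality
  using (_≡_; refl; trans; cong; cong₂; subst)
import Relation.Binary.PropositionalEquality as ≡
open import Algebra.Properties.Semiring.Sum +-*-semiring
  using (sum; sum-cong-≗; sum-replicate-zero; ∑-comm; *-distribˡ-sum; *-distribʳ-sum)

private
  variable
    n : ℕ
    x : Fin n
    p q : Subset n

∣p∪q∣+∣p∩q∣≡∣p∣+∣q∣ : ∀ (p q : Subset n) → ∣ p ∪ q ∣ + ∣ p ∩ q ∣ ≡ ∣ p ∣ + ∣ q ∣
∣p∪q∣+∣p∩q∣≡∣p∣+∣q∣ []            []            = refl
∣p∪q∣+∣p∩q∣≡∣p∣+∣q∣ (inside  ∷ p) (inside  ∷ q) =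
  cong suc (trans (+-suc _ _) (trans (cong suc (∣p∪q∣+∣p∩q∣≡∣p∣+∣q∣ p q)) (≡.sym (+-suc _ _))))
∣p∪q∣+∣p∩q∣≡∣p∣+∣q∣ (inside  ∷ p) (outside ∷ q) = cong suc (∣p∪q∣+∣p∩q∣≡∣p∣+∣q∣ p q)
∣p∪q∣+∣p∩q∣≡∣p∣+∣q∣ (outside ∷ p) (inside  ∷ q) =
  trans (cong suc (∣p∪q∣+∣p∩q∣≡∣p∣+∣q∣ p q)) (≡.sym (+-suc _ _))
∣p∪q∣+∣p∩q∣≡∣p∣+∣q∣ (outside ∷ p) (outside ∷ q) = ∣p∪q∣+∣p∩q∣≡∣p∣+∣q∣ p q

∣p∪q∣≤∣p∣+∣q∣ : ∀ (p q : Subset n) → ∣ p ∪ q ∣ ≤ ∣ p ∣ + ∣ q ∣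
∣p∪q∣≤∣p∣+∣q∣ p q = subst (∣ p ∪ q ∣ ≤_) (∣p∪q∣+∣p∩q∣≡∣p∣+∣q∣ p q) (m≤m+n _ _)

x∈p⇒0<∣p∣ : x ∈ p → 0 < ∣ p ∣
x∈p⇒0<∣p∣ {x = x} {p = p} x∈p = subst (_≤ ∣ p ∣) (∣⁅x⁆∣≡1 x) (p⊆q⇒∣p∣≤∣q∣ ⁅x⁆⊆p)
  where
  ⁅x⁆⊆p : ⁅ x ⁆ ⊆ p
  ⁅x⁆⊆p y∈⁅x⁆ = subst (_∈ p) (≡.sym (x∈⁅y⁆⇒x≡y x y∈⁅x⁆)) x∈p

x∈p∩q⇒∣p∪q∣<∣p∣+∣q∣ : ∀ (p q : Subset n) → x ∈ p → x ∈ q → ∣ p ∪ q ∣ < ∣ p ∣ + ∣ q ∣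
x∈p∩q⇒∣p∪q∣<∣p∣+∣q∣ p q x∈p x∈q = begin-strict
  ∣ p ∪ q ∣                ≡⟨ +-identityʳ _ ⟨
  ∣ p ∪ q ∣ + 0            <⟨ +-monoʳ-< ∣ p ∪ q ∣ (x∈p⇒0<∣p∣ (x∈p∩q⁺ (x∈p , x∈q))) ⟩
  ∣ p ∪ q ∣ + ∣ p ∩ q ∣    ≡⟨ ∣p∪q∣+∣p∩q∣≡∣p∣+∣q∣ p q ⟩
  ∣ p ∣ + ∣ q ∣            ∎
  where open ≤-Reasoning

x∈⁅y⁆∪p⁻ : ∀ y (p : Subset n) → x ∈ ⁅ y ⁆ ∪ p → x ≡ y ⊎ x ∈ p
x∈⁅y⁆∪p⁻ y p = [ inj₁ ∘ x∈⁅y⁆⇒x≡y y , inj₂ ] ∘ x∈p∪q⁻ ⁅ y ⁆ p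

x∉p⇒p⊂⁅x⁆∪p : x ∉ p → p ⊂ ⁅ x ⁆ ∪ p
x∉p⇒p⊂⁅x⁆∪p {x = x} {p = p} x∉p = q⊆p∪q ⁅ x ⁆ p , x , p⊆p∪q p (x∈⁅x⁆ x) , x∉p

toSubset : List (Fin n) → Subset n
toSubset xs = ⋃ (map ⁅_⁆ xs)

∈toSubset⁺ : ∀ {xs : List (Fin n)} → x List.∈ xs → x ∈ toSubset xs
∈toSubset⁺ {xs = y ∷ ys} (here refl) = p⊆p∪q (toSubset ys) (x∈⁅x⁆ y)
∈toSubset⁺ {xs = y ∷ ys} (there x∈ys) = q⊆p∪q ⁅ y ⁆ (toSubset ys) (∈toSubset⁺ x∈ys)

∈toSubset⁻ : ∀ (xs : List (Fin n)) → x ∈ toSubset xs → x List.∈ xs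
∈toSubset⁻ []       x∈⊥ = contradiction x∈⊥ ∉⊥
∈toSubset⁻ (y ∷ ys) = [ here , there ∘ ∈toSubset⁻ ys ] ∘ x∈⁅y⁆∪p⁻ y (toSubset ys)

∣toSubset∣≤length : ∀ (xs : List (Fin n)) → ∣ toSubset xs ∣ ≤ length xs
∣toSubset∣≤length {n} []       = ≤-reflexive (∣⊥∣≡0 n)
∣toSubset∣≤length (x ∷ xs) = begin
  ∣ ⁅ x ⁆ ∪ toSubset xs ∣      ≤⟨ ∣p∪q∣≤∣p∣+∣q∣ ⁅ x ⁆ (toSubset xs) ⟩
  ∣ ⁅ x ⁆ ∣ + ∣ toSubset xs ∣  ≡⟨ cong (_+ ∣ toSubset xs ∣) (∣⁅x⁆∣≡1 x) ⟩
  suc ∣ toSubset xs ∣          ≤⟨ s≤s (∣toSubset∣≤length xs) ⟩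
  suc (length xs)              ∎
  where open ≤-Reasoning

unique⇒length≤∣toSubset∣ : ∀ {xs : List (Fin n)} → Unique xs → length xs ≤ ∣ toSubset xs ∣
unique⇒length≤∣toSubset∣ {xs = []}     _ = z≤n
unique⇒length≤∣toSubset∣ {xs = x ∷ xs} (x∉xs ∷ unique) =
  ≤-trans (s≤s (unique⇒length≤∣toSubset∣ unique))
          (p⊂q⇒∣p∣<∣q∣ (x∉p⇒p⊂⁅x⁆∪p (All¬⇒¬Any x∉xs ∘ ∈toSubset⁻ xs)))

unique⇒∣toSubset∣≡length : ∀ {xs : List (Fin n)} → Unique xs → ∣ toSubset xs ∣ ≡ length xs
unique⇒∣toSubset∣≡length {xs = xs} unique =
  ≤-antisym (∣toSubset∣≤length xs) (unique⇒length≤∣toSubset∣ unique)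

unique⇒length≤n : ∀ {xs : List (Fin n)} → Unique xs → length xs ≤ n
unique⇒length≤n {xs = xs} unique = ≤-trans (unique⇒length≤∣toSubset∣ unique) (∣p∣≤n (toSubset xs))

𝟙 : Subset n → Fin n → ℕ
𝟙 p x = if does (x ∈? p) then 1 else 0

𝟙-resp-⇔ : ∀ {y : Fin n} → (x ∈ p ⇔ y ∈ q) → 𝟙 p x ≡ 𝟙 q y
𝟙-resp-⇔ {x = x} {p = p} {q = q} {y = y} x∈p⇔y∈q with x ∈? p | y ∈? q
... | yes _   | yes _   = refl
... | no  _   | no  _   = refl
... | yes x∈p | no  y∉q = contradiction (Equivalence.to x∈p⇔y∈q x∈p) y∉q
... | no  x∉p | yes y∈q = contradiction (Equivalence.from x∈p⇔y∈q y∈q) x∉p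

∣p∣≡∑𝟙 : ∀ (p : Subset n) → ∣ p ∣ ≡ sum (𝟙 p)
∣p∣≡∑𝟙 []            = refl
∣p∣≡∑𝟙 (inside  ∷ p) = cong suc (∣p∣≡∑𝟙 p)
∣p∣≡∑𝟙 (outside ∷ p) = ∣p∣≡∑𝟙 p

sum-mono-≤ : ∀ {f g : Fin n → ℕ} → (∀ i → f i ≤ g i) → sum f ≤ sum g
sum-mono-≤ {zero}  f≤g = z≤n
sum-mono-≤ {suc n} f≤g = +-mono-≤ (f≤g zero) (sum-mono-≤ (f≤g ∘ suc))

walk-start : ∀ {G : Graph n} {P : Fin n → Set} {u v} → WalkIn G P u v → P u
walk-start (here Pu)     = Pu
walk-start (step Pu _ _) = Pu

walk-leaves : ∀ {G : Graph n} {P Q : Fin n → Set} → Decidable P → ∀ {u v} →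
  WalkIn G Q u v → P u → ¬ P v → ∃₂ λ x y → P x × ¬ P y × Q y × Adj G x y
walk-leaves P? (here _) Pu ¬Pv = contradiction Pu ¬Pv
walk-leaves P? {u} (step {w = w} _ u~w walk) Pu ¬Pv with P? w
... | yes Pw = walk-leaves P? walk Pw ¬Pv
... | no ¬Pw = u , w , Pu , ¬Pw , walk-start walk , u~w

Regular : ℕ → Graph n → Set
Regular {n} k G = ∀ v → Σ (List (Fin n)) λ N →
  length N ≡ k × Unique N × (∀ w → (Adj G v w ⇔ w List.∈ N))

module _ {G : Graph n} {d : ℕ} (regular : Regular (suc d) G) where

  N : Fin n → Subset n
  N v = toSubset (proj₁ (regular v))

  Adj⇒∈N : ∀ {v w} → Adj G v w → w ∈ N v
  Adj⇒∈N {v} {w} with regular v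
  ... | _ , _ , _ , Adj⇔∈ = ∈toSubset⁺ ∘ Equivalence.to (Adj⇔∈ w)

  ∈N⇒Adj : ∀ {v w} → w ∈ N v → Adj G v w
  ∈N⇒Adj {v} {w} with regular v
  ... | neighbours , _ , _ , Adj⇔∈ = Equivalence.from (Adj⇔∈ w) ∘ ∈toSubset⁻ neighbours

  ∈N-sym : ∀ {v w} → w ∈ N v ⇔ v ∈ N w
  ∈N-sym = mk⇔ (Adj⇒∈N ∘ Graph.sym G ∘ ∈N⇒Adj) (Adj⇒∈N ∘ Graph.sym G ∘ ∈N⇒Adj)

  ∣N∣≡1+d : ∀ v → ∣ N v ∣ ≡ suc d
  ∣N∣≡1+d v with regular v
  ... | _ , length≡ , unique , _ = trans (unique⇒∣toSubset∣≡length unique) length≡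

  independent⇒∣I∣≤∣∁I∣ : ∀ {I : Subset n} → IsIndependent G I → ∣ I ∣ ≤ ∣ ∁ I ∣
  -- Each u ∈ I sends d + 1 edges out of I, and each w ∉ I receives at most d + 1 of them.
  independent⇒∣I∣≤∣∁I∣ {I} independent = *-cancelʳ-≤ ∣ I ∣ ∣ ∁ I ∣ (suc d) (begin
    ∣ I ∣ * suc d                               ≡⟨ cong (_* suc d) (∣p∣≡∑𝟙 I) ⟩
    sum (𝟙 I) * suc d                           ≡⟨ *-distribʳ-sum (suc d) (𝟙 I) ⟩
    sum (λ u → 𝟙 I u * suc d)                   ≡⟨ sum-cong-≗ edges-from ⟩
    sum (λ u → sum (λ w → 𝟙 I u * 𝟙 (N u) w))   ≡⟨ ∑-comm (λ u w → 𝟙 I u * 𝟙 (N u) w) ⟩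
    sum (λ w → sum (λ u → 𝟙 I u * 𝟙 (N u) w))   ≤⟨ sum-mono-≤ edges-into ⟩
    sum (λ w → 𝟙 (∁ I) w * suc d)               ≡⟨ *-distribʳ-sum (suc d) (𝟙 (∁ I)) ⟨
    sum (𝟙 (∁ I)) * suc d                       ≡⟨ cong (_* suc d) (∣p∣≡∑𝟙 (∁ I)) ⟨
    ∣ ∁ I ∣ * suc d                             ∎)
    where
    open ≤-Reasoning

    edges-from : ∀ u → 𝟙 I u * suc d ≡ sum (λ w → 𝟙 I u * 𝟙 (N u) w)
    edges-from u = trans (cong (𝟙 I u *_) (trans (≡.sym (∣N∣≡1+d u)) (∣p∣≡∑𝟙 (N u))))
                         (*-distribˡ-sum (𝟙 I u) (𝟙 (N u)))

    edges-into : ∀ w → sum (λ u → 𝟙 I u * 𝟙 (N u) w) ≤ 𝟙 (∁ I) w * suc d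
    edges-into w with w ∈? ∁ I
    ... | no w∉∁I = ≤-trans (sum-mono-≤ no-edge) (≤-reflexive (sum-replicate-zero n))
      where
      no-edge : ∀ u → 𝟙 I u * 𝟙 (N u) w ≤ 0
      no-edge u with u ∈? I | w ∈? N u
      ... | no _    | _       = z≤n
      ... | yes _   | no _    = z≤n
      ... | yes u∈I | yes w∈Nu = contradiction (∈N⇒Adj w∈Nu) (independent u w u∈I (x∉∁p⇒x∈p w∉∁I))
    ... | yes _ = begin
      sum (λ u → 𝟙 I u * 𝟙 (N u) w)   ≤⟨ sum-mono-≤ at-most-adjacent ⟩
      sum (𝟙 (N w))                   ≡⟨ ∣p∣≡∑𝟙 (N w) ⟨
      ∣ N w ∣                         ≡⟨ ∣N∣≡1+d w ⟩
      suc d                           ≡⟨ *-identityˡ (suc d) ⟨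
      1 * suc d                       ∎
      where
      at-most-adjacent : ∀ u → 𝟙 I u * 𝟙 (N u) w ≤ 𝟙 (N w) u
      at-most-adjacent u with u ∈? I
      ... | no _  = z≤n
      ... | yes _ = ≤-reflexive (trans (+-identityʳ _) (𝟙-resp-⇔ (∈N-sym {u} {w})))

  independent⇒2∣I∣≤n : ∀ {I : Subset n} → IsIndependent G I → 2 * ∣ I ∣ ≤ n
  independent⇒2∣I∣≤n {I} independent = begin
    2 * ∣ I ∣              ≡⟨ cong (∣ I ∣ +_) (+-identityʳ ∣ I ∣) ⟩
    ∣ I ∣ + ∣ I ∣          ≤⟨ +-monoʳ-≤ ∣ I ∣ (independent⇒∣I∣≤∣∁I∣ independent) ⟩
    ∣ I ∣ + ∣ ∁ I ∣        ≡⟨ cong (∣ I ∣ +_) (∣∁p∣≡n∸∣p∣ I) ⟩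
    ∣ I ∣ + (n ∸ ∣ I ∣)    ≡⟨ m+[n∸m]≡n (∣p∣≤n I) ⟩
    n                      ∎
    where open ≤-Reasoning

  module _ {S : Subset n} (cds : IsConnectedDominating G S) where

    record Cover (T C : Subset n) : Set where
      field
        T⊆S        : T ⊆ S
        root       : Nonempty T
        T⊆C        : T ⊆ C
        N[T]⊆C     : ∀ {u v} → u ∈ T → Adj G u v → v ∈ C
        ∣C∣≤d∣T∣+2 : ∣ C ∣ ≤ d * ∣ T ∣ + 2

    cover-start : ∀ {r} → r ∈ S → Cover ⁅ r ⁆ (⁅ r ⁆ ∪ N r)
    cover-start {r} r∈S = record
      { T⊆S        = λ u∈⁅r⁆ → subst (_∈ S) (≡.sym (x∈⁅y⁆⇒x≡y r u∈⁅r⁆)) r∈S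
      ; root       = r , x∈⁅x⁆ r
      ; T⊆C        = p⊆p∪q (N r)
      ; N[T]⊆C     = N[r]⊆C
      ; ∣C∣≤d∣T∣+2 = begin
          ∣ ⁅ r ⁆ ∪ N r ∣          ≤⟨ ∣p∪q∣≤∣p∣+∣q∣ ⁅ r ⁆ (N r) ⟩
          ∣ ⁅ r ⁆ ∣ + ∣ N r ∣      ≡⟨ cong₂ _+_ (∣⁅x⁆∣≡1 r) (∣N∣≡1+d r) ⟩
          2 + d                    ≡⟨ +-comm 2 d ⟩
          d + 2                    ≡⟨ cong (_+ 2) (*-identityʳ d) ⟨
          d * 1 + 2                ≡⟨ cong (λ k → d * k + 2) (∣⁅x⁆∣≡1 r) ⟨
          d * ∣ ⁅ r ⁆ ∣ + 2        ∎
      }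
      where
      open ≤-Reasoning

      N[r]⊆C : ∀ {u v} → u ∈ ⁅ r ⁆ → Adj G u v → v ∈ ⁅ r ⁆ ∪ N r
      N[r]⊆C u∈⁅r⁆ u~v with x∈⁅y⁆⇒x≡y r u∈⁅r⁆
      ... | refl = q⊆p∪q ⁅ r ⁆ (N r) (Adj⇒∈N u~v)

    cover-extend : ∀ {T C t s} → Cover T C → t ∈ T → s ∈ S → s ∉ T → Adj G t s →
                   Cover (⁅ s ⁆ ∪ T) (C ∪ N s)
    cover-extend {T} {C} {t} {s} cover t∈T s∈S s∉T t~s = record
      { T⊆S        = T′⊆S
      ; root       = proj₁ root , q⊆p∪q ⁅ s ⁆ T (proj₂ root)
      ; T⊆C        = T′⊆C′
      ; N[T]⊆C     = N[T′]⊆C′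
      ; ∣C∣≤d∣T∣+2 = begin
          ∣ C ∪ N s ∣                 ≤⟨ ∣C∪Ns∣≤∣C∣+d ⟩
          ∣ C ∣ + d                   ≤⟨ +-monoˡ-≤ d ∣C∣≤d∣T∣+2 ⟩
          d * ∣ T ∣ + 2 + d           ≡⟨ +-comm (d * ∣ T ∣ + 2) d ⟩
          d + (d * ∣ T ∣ + 2)         ≡⟨ +-assoc d (d * ∣ T ∣) 2 ⟨
          d + d * ∣ T ∣ + 2           ≡⟨ cong (_+ 2) (*-suc d ∣ T ∣) ⟨
          d * suc ∣ T ∣ + 2           ≤⟨ +-monoˡ-≤ 2 (*-monoʳ-≤ d (p⊂q⇒∣p∣<∣q∣ (x∉p⇒p⊂⁅x⁆∪p s∉T))) ⟩
          d * ∣ ⁅ s ⁆ ∪ T ∣ + 2       ∎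
      }
      where
      open Cover cover
      open ≤-Reasoning

      T′⊆S : ⁅ s ⁆ ∪ T ⊆ S
      T′⊆S u∈T′ with x∈⁅y⁆∪p⁻ s T u∈T′
      ... | inj₁ refl = s∈S
      ... | inj₂ u∈T  = T⊆S u∈T

      T′⊆C′ : ⁅ s ⁆ ∪ T ⊆ C ∪ N s
      T′⊆C′ u∈T′ with x∈⁅y⁆∪p⁻ s T u∈T′
      ... | inj₁ refl = p⊆p∪q (N s) (N[T]⊆C t∈T t~s)
      ... | inj₂ u∈T  = p⊆p∪q (N s) (T⊆C u∈T)

      N[T′]⊆C′ : ∀ {u v} → u ∈ ⁅ s ⁆ ∪ T → Adj G u v → v ∈ C ∪ N s
      N[T′]⊆C′ u∈T′ u~v with x∈⁅y⁆∪p⁻ s T u∈T′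
      ... | inj₁ refl = q⊆p∪q C (N s) (Adj⇒∈N u~v)
      ... | inj₂ u∈T  = p⊆p∪q (N s) (N[T]⊆C u∈T u~v)

      ∣C∪Ns∣≤∣C∣+d : ∣ C ∪ N s ∣ ≤ ∣ C ∣ + d
      ∣C∪Ns∣≤∣C∣+d = ≤-pred (begin-strict
        ∣ C ∪ N s ∣        <⟨ x∈p∩q⇒∣p∪q∣<∣p∣+∣q∣ C (N s) (T⊆C t∈T) (Adj⇒∈N (Graph.sym G t~s)) ⟩
        ∣ C ∣ + ∣ N s ∣    ≡⟨ cong (∣ C ∣ +_) (∣N∣≡1+d s) ⟩
        ∣ C ∣ + suc d      ≡⟨ +-suc ∣ C ∣ d ⟩
        suc (∣ C ∣ + d)    ∎)

    saturated-cover⇒n≤d∣S∣+2 : ∀ {T C} → Cover T C → S ⊆ T → n ≤ d * ∣ S ∣ + 2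
    saturated-cover⇒n≤d∣S∣+2 {T} {C} cover S⊆T = begin
      n                  ≡⟨ ∣⊤∣≡n n ⟨
      ∣ ⊤ {n} ∣          ≤⟨ p⊆q⇒∣p∣≤∣q∣ {p = ⊤} (λ {v} _ → covered v) ⟩
      ∣ C ∣              ≤⟨ ∣C∣≤d∣T∣+2 ⟩
      d * ∣ T ∣ + 2      ≤⟨ +-monoˡ-≤ 2 (*-monoʳ-≤ d (p⊆q⇒∣p∣≤∣q∣ T⊆S)) ⟩
      d * ∣ S ∣ + 2      ∎
      where
      open Cover cover
      open ≤-Reasoning

      covered : ∀ v → v ∈ C
      covered v with v ∈? S
      ... | yes v∈S = T⊆C (S⊆T v∈S)
      ... | no  v∉S with proj₁ cds v v∉S
      ...   | u , u∈S , v~u = N[T]⊆C (S⊆T u∈S) (Graph.sym G v~u)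

    grow : ∀ {T C} → Acc _⊃_ T → Cover T C → n ≤ d * ∣ S ∣ + 2
    grow {T} (acc larger) cover with Cover.root cover | any? (λ v → v ∈? S ×-dec ¬? (v ∈? T))
    ... | _ , _ | no S⊈T = saturated-cover⇒n≤d∣S∣+2 cover
      (λ {v} v∈S → decidable-stable (v ∈? T) (λ v∉T → S⊈T (v , v∈S , v∉T)))
    ... | r , r∈T | yes (s , s∈S , s∉T)
      with walk-leaves (_∈? T) (proj₂ cds r s (Cover.T⊆S cover r∈T) s∈S) r∈T s∉T
    ... | t , s′ , t∈T , s′∉T , s′∈S , t~s′ =
      grow (larger (x∉p⇒p⊂⁅x⁆∪p s′∉T)) (cover-extend cover t∈T s′∈S s′∉T t~s′)

dominating⇒nonempty : ∀ {G : Graph n} {S} → IsConnectedDominating G S → Fin n → Nonempty S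
dominating⇒nonempty {S = S} cds v with v ∈? S
... | yes v∈S = v , v∈S
... | no  v∉S with proj₁ cds v v∉S
...   | u , u∈S , _ = u , u∈S

connectedDominating⇒n≤d∣S∣+2 : ∀ {G : Graph n} {d S} → Regular (suc d) G →
  IsConnectedDominating G S → n ≤ d * ∣ S ∣ + 2
connectedDominating⇒n≤d∣S∣+2 {zero}  _       _   = z≤n
connectedDominating⇒n≤d∣S∣+2 {suc _} regular cds with dominating⇒nonempty cds zero
... | _ , r∈S = grow regular cds (⊃-wellFounded _) (cover-start regular cds r∈S)

length-endpoints : ∀ (M : List (Fin n × Fin n)) → length (endpoints M) ≡ 2 * length M
length-endpoints []            = refl
length-endpoints ((u , v) ∷ M) =
  trans (cong (2 +_) (length-endpoints M)) (≡.sym (*-suc 2 (length M)))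

matching⇒2∣M∣≤n : ∀ {G : Graph n} {M} → IsMatching G M → 2 * length M ≤ n
matching⇒2∣M∣≤n {M = M} (_ , unique) =
  subst (_≤ _) (length-endpoints M) (unique⇒length≤n unique)

corollary6 : ∀ {n} (G : Graph n) → Connected G → Cubic G →
    (∀ (S : Subset n) (M : List (Fin n × Fin n)) →
      IsConnectedDominating G S → IsMatching G M → length M ≤ suc ∣ S ∣) ×
    (∀ (S : Subset n) (I : Subset n) →
      IsConnectedDominating G S → IsIndependent G I → ∣ I ∣ ≤ suc ∣ S ∣)
corollary6 {n} G _ cubic =
    (λ S M cds matching → halve S (≤-trans (matching⇒2∣M∣≤n {G = G} matching) (n≤2∣S∣+2 cds)))
  , (λ S I cds independent →
       halve S (≤-trans (independent⇒2∣I∣≤n {G = G} cubic independent) (n≤2∣S∣+2 cds)))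
  where
  n≤2∣S∣+2 : ∀ {S} → IsConnectedDominating G S → n ≤ 2 * ∣ S ∣ + 2
  n≤2∣S∣+2 = connectedDominating⇒n≤d∣S∣+2 cubic

  halve : ∀ {a} S → 2 * a ≤ 2 * ∣ S ∣ + 2 → a ≤ suc ∣ S ∣
  halve {a} S 2a≤ = *-cancelˡ-≤ 2
    (subst (2 * a ≤_) (trans (+-comm (2 * ∣ S ∣) 2) (≡.sym (*-suc 2 ∣ S ∣))) 2a≤)
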